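{- Let $Q=ABA'B'$ be a quadrilateral, possibly improper, over a field $\mathbb{k}$ of characteristic $\neq 2$. Then $A$ and $A'$ are $Q$-orthogonal, $B$ and $B'$ are $Q$-orthogonal, and the two diagonals of $Q$ are $Q$-orthogonal.
   Context: Work in $\mathbb{k}^2$. Every line $L$ has an equation $tX-uY+v=0$ normalized so that $t=1$ if $u=0$ and $u=1$ if $u\ne0$; write $t_L,u_L,v_L$. A quadrilateral $Q=ABA'B'$: four distinct lines $A,B,A',B'$ (sides), not all concurrent, adjacent sides ($\{A,B\},\{B,A'\},\{A',B'\},\{B',A\}$) not parallel (opposite sides $\{A,A'\},\{B,B'\}$ may be parallel). Vertices $A\cap B,B\cap A',A'\cap B',B'\cap A$; if three sides are concurrent two vertices coincide and $Q$ is improper. Diagonals: the line through $A\cap B$ and $A'\cap B'$, and the line through $B\cap A'$ and $B'\cap A$. $\alpha = t_Au_Bu_{A'}u_{B'} - u_At_Bu_{A'}u_{B'} + u_Au_Bt_{A'}u_{B'} - u_Au_Bu_{A'}t_{B'}$, $\beta = t_Au_Bt_{A'}u_{B'}-u_At_Bu_{A'}t_{B'}$, $\gamma = t_At_Bt_{A'}u_{B'}-t_At_Bu_{A'}t_{B'}+t_Au_Bt_{A'}t_{B'}-u_At_Bt_{A'}t_{B'}$; $\langle \mathbf v,\mathbf w\rangle_Q=\mathbf v^T\begin{pmatrix}\gamma&-\beta\\-\beta&\alpha\end{pmatrix}\mathbf w$. Lines $\ell_1,\ell_2$ are $Q$-orthogonal if $\langle (u_{\ell_1},t_{\ell_1}),(u_{\ell_2},t_{\ell_2})\rangle_Q=0$.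 -}

module Defs where

open import Level using (Level; _⊔_; suc)
open import Algebra.Bundles using (CommutativeRing)
open import Data.Product using (Σ; ∃; _×_; _,_)
open import Data.Sum using (_⊎_)
open import Relation.Nullary using (¬_)

record Field (c ℓ : Level) : Set (suc (c ⊔ ℓ)) where
  field
    commRing : CommutativeRing c ℓ
  open CommutativeRing commRing public
  field
    0≉1     : ¬ (0# ≈ 1#)
    inverse : ∀ x → ¬ (x ≈ 0#) → Σ Carrier λ y → x * y ≈ 1#

CharNot2 : ∀ {c ℓ} → Field c ℓ → Set ℓ
CharNot2 F = ¬ (1# + 1# ≈ 0#)
  where open Field F

module Geometry {c ℓ} (F : Field c ℓ) where
  open Field F

  Point : Set c
  Point = Carrier × Carrier

  -- a line  t X - u Y + v = 0  with the paper's normalisation: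
  -- t = 1 if u = 0, and u = 1 if u ≠ 0
  record Line : Set (c ⊔ ℓ) where
    constructor line
    field
      t u v : Carrier
      normalised : (u ≈ 0# × t ≈ 1#) ⊎ u ≈ 1#
  open Line public

  _∈L_ : Point → Line → Set ℓ
  (x , y) ∈L L = t L * x - u L * y + v L ≈ 0#

  -- equality of (normalised) lines = equality of their normalised equations
  SameLine : Line → Line → Set ℓ
  SameLine L M = t L ≈ t M × u L ≈ u M × v L ≈ v M

  Parallel : Line → Line → Set ℓ
  Parallel L M = t L ≈ t M × u L ≈ u M

  Concurrent4 : Line → Line → Line → Line → Set (c ⊔ ℓ)
  Concurrent4 A B A' B' = Σ Point λ P → P ∈L A × P ∈L B × P ∈L A' × P ∈L B'

  record IsQuadrilateral (A B A' B' : Line) : Set (c ⊔ ℓ) where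
    field
      dAB   : ¬ SameLine A B
      dAA'  : ¬ SameLine A A'
      dAB'  : ¬ SameLine A B'
      dBA'  : ¬ SameLine B A'
      dBB'  : ¬ SameLine B B'
      dA'B' : ¬ SameLine A' B'
      notAllConcurrent : ¬ Concurrent4 A B A' B'
      npAB   : ¬ Parallel A B
      npBA'  : ¬ Parallel B A'
      npA'B' : ¬ Parallel A' B'
      npB'A  : ¬ Parallel B' A

  αQ βQ γQ : Line → Line → Line → Line → Carrier
  αQ A B A' B' =
    t A * u B * u A' * u B' - u A * t B * u A' * u B'
    + u A * u B * t A' * u B' - u A * u B * u A' * t B'
  βQ A B A' B' = t A * u B * t A' * u B' - u A * t B * u A' * t B'
  γQ A B A' B' =
    t A * t B * t A' * u B' - t A * t B * u A' * t B'
    + t A * u B * t A' * t B' - u A * t B * t A' * t B'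

  ⟪_,_⟫[_,_,_,_] : Carrier × Carrier → Carrier × Carrier
                 → Line → Line → Line → Line → Carrier
  ⟪ (v₁ , v₂) , (w₁ , w₂) ⟫[ A , B , A' , B' ] =
    v₁ * (γ * w₁ + (- β) * w₂) + v₂ * ((- β) * w₁ + α * w₂)
    where
      α = αQ A B A' B'
      β = βQ A B A' B'
      γ = γQ A B A' B'

  QOrthogonal : (A B A' B' : Line) → Line → Line → Set ℓ
  QOrthogonal A B A' B' ℓ₁ ℓ₂ =
    ⟪ (u ℓ₁ , t ℓ₁) , (u ℓ₂ , t ℓ₂) ⟫[ A , B , A' , B' ] ≈ 0#

-- Opposite sides: the orthogonality of A and A' (and of B and B') is a polynomial
-- identity in the coefficients of the four sides. Diagonals: by Cramer's rule the
-- vertex L ∩ M, scaled by det L M = u L t M − t L u M, is a polynomial in the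
-- coefficients, so the difference of the two vertices on a diagonal, scaled by the
-- two determinants, is a multiple κ of the diagonal's direction (u D, t D). The
-- Q-form of these two polynomial vectors vanishes identically, and κ ≠ 0 because
-- adjacent sides are not parallel and a diagonal joins two distinct vertices (the
-- four sides are not concurrent); cancelling κ₁ κ₂ gives the claim.
module Submission where

open import Defs
open import Algebra.Bundles using (CommutativeRing; RawRing)
open import Level using (0ℓ; _⊔_)
open import Data.Nat as ℕ using (ℕ; zero; suc)
import Data.Nat.Properties as ℕ
open import Data.Integer as ℤ using (ℤ; +_; -[1+_]; _⊖_; _◃_)
import Data.Integer.Properties as ℤ
open import Data.Sign as Sign using (Sign)
open import Data.Maybe using (Maybe; just; nothing)
open import Data.Product using (Σ; _×_; _,_; proj₁; proj₂)
open import Data.Product.Relation.Binary.Pointwise.NonDependent using (Pointwise; ×-symmetric)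
open import Function using (_∘_)
open import Data.Sum using (inj₁; inj₂)
open import Relation.Nullary using (¬_; yes; no)
open import Data.Empty using (⊥-elim)
open import Relation.Binary.PropositionalEquality as ≡ using (_≡_)

-- The solver needs coefficients with decidable equality to reach normal forms, so
-- integers are mapped into the ring.
module ℤ-CoefficientRingSolver {c ℓ} (R : CommutativeRing c ℓ) where
  open CommutativeRing R
  open import Algebra.Properties.Ring ring
    using (-0#≈0#; -‿involutive; -‿+-comm; -1*x≈-x)
  open import Algebra.Properties.CommutativeSemigroup +-commutativeSemigroup
    using () renaming (interchange to +-interchange)
  open import Algebra.Properties.CommutativeSemigroup *-commutativeSemigroup
    using () renaming (interchange to *-interchange)
  open import Algebra.Properties.Semiring.Mult semiring using (×-homo-+; ×1-homo-*)
    renaming (_×_ to _×ᵣ_)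
  open import Algebra.Solver.Ring.AlmostCommutativeRing
    using (fromCommutativeRing; _-Raw-AlmostCommutative⟶_)
  open import Relation.Binary.Reasoning.Setoid setoid

  cast : ℤ → Carrier
  cast (+ n)    = n ×ᵣ 1#
  cast -[1+ n ] = - (suc n ×ᵣ 1#)

  cast-⊖ : ∀ m n → cast (m ⊖ n) ≈ m ×ᵣ 1# - n ×ᵣ 1#
  cast-⊖ m zero = begin
    cast (m ⊖ 0)     ≡⟨ ≡.cong cast (ℤ.⊖-≥ {m} ℕ.z≤n) ⟩
    m ×ᵣ 1#           ≈⟨ +-identityʳ _ ⟨
    m ×ᵣ 1# + 0#      ≈⟨ +-congˡ -0#≈0# ⟨
    m ×ᵣ 1# - 0 ×ᵣ 1#  ∎
  cast-⊖ zero (suc n) = sym (+-identityˡ _)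
  cast-⊖ (suc m) (suc n) = begin
    cast (suc m ⊖ suc n)             ≡⟨ ≡.cong cast (ℤ.[1+m]⊖[1+n]≡m⊖n m n) ⟩
    cast (m ⊖ n)                     ≈⟨ cast-⊖ m n ⟩
    m ×ᵣ 1# - n ×ᵣ 1#                  ≈⟨ +-identityˡ _ ⟨
    0# + (m ×ᵣ 1# - n ×ᵣ 1#)           ≈⟨ +-congʳ (-‿inverseʳ 1#) ⟨
    (1# - 1#) + (m ×ᵣ 1# - n ×ᵣ 1#)    ≈⟨ +-interchange _ _ _ _ ⟩
    (1# + m ×ᵣ 1#) + (- 1# - n ×ᵣ 1#)  ≈⟨ +-congˡ (-‿+-comm 1# (n ×ᵣ 1#)) ⟩
    suc m ×ᵣ 1# - suc n ×ᵣ 1#          ∎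

  cast-+ : ∀ i j → cast (i ℤ.+ j) ≈ cast i + cast j
  cast-+ -[1+ m ] -[1+ n ] = begin
    - (suc (suc (m ℕ.+ n)) ×ᵣ 1#)     ≡⟨ ≡.cong (λ k → - (k ×ᵣ 1#)) (ℕ.+-suc (suc m) n) ⟨
    - ((suc m ℕ.+ suc n) ×ᵣ 1#)       ≈⟨ -‿cong (×-homo-+ 1# (suc m) (suc n)) ⟩
    - (suc m ×ᵣ 1# + suc n ×ᵣ 1#)      ≈⟨ -‿+-comm _ _ ⟨
    - (suc m ×ᵣ 1#) + - (suc n ×ᵣ 1#)  ∎
  cast-+ -[1+ m ] (+ n)    = trans (cast-⊖ n (suc m)) (+-comm _ _)
  cast-+ (+ m)    -[1+ n ] = cast-⊖ m (suc n)
  cast-+ (+ m)    (+ n)    = ×-homo-+ 1# m n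

  cast-neg : ∀ i → cast (ℤ.- i) ≈ - cast i
  cast-neg -[1+ n ]  = sym (-‿involutive _)
  cast-neg (+ zero)  = sym -0#≈0#
  cast-neg (+ suc n) = refl

  castSign : Sign → Carrier
  castSign Sign.+ = 1#
  castSign Sign.- = - 1#

  castSign-* : ∀ s s′ → castSign (s Sign.* s′) ≈ castSign s * castSign s′
  castSign-* Sign.- Sign.- = sym (trans (-1*x≈-x _) (-‿involutive _))
  castSign-* Sign.- Sign.+ = sym (*-identityʳ _)
  castSign-* Sign.+ _      = sym (*-identityˡ _)

  cast-◃ : ∀ s n → cast (s ◃ n) ≈ castSign s * n ×ᵣ 1#
  cast-◃ _      zero    = sym (zeroʳ _)
  cast-◃ Sign.- (suc n) = sym (-1*x≈-x _)
  cast-◃ Sign.+ (suc n) = sym (*-identityˡ _)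

  cast-signAbs : ∀ i → cast i ≈ castSign (ℤ.sign i) * ℤ.∣ i ∣ ×ᵣ 1#
  cast-signAbs i = trans (reflexive (≡.cong cast (≡.sym (ℤ.◃-inverse i))))
                         (cast-◃ (ℤ.sign i) ℤ.∣ i ∣)

  cast-* : ∀ i j → cast (i ℤ.* j) ≈ cast i * cast j
  cast-* i j = begin
    cast (i ℤ.* j)                                  ≈⟨ cast-◃ (s Sign.* s′) (n ℕ.* n′) ⟩
    castSign (s Sign.* s′) * (n ℕ.* n′) ×ᵣ 1#        ≈⟨ *-cong (castSign-* s s′) (×1-homo-* n n′) ⟩
    (castSign s * castSign s′) * (n ×ᵣ 1# * n′ ×ᵣ 1#) ≈⟨ *-interchange _ _ _ _ ⟩
    (castSign s * n ×ᵣ 1#) * (castSign s′ * n′ ×ᵣ 1#) ≈⟨ *-cong (cast-signAbs i) (cast-signAbs j) ⟨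
    cast i * cast j                                 ∎
    where s = ℤ.sign i ; s′ = ℤ.sign j ; n = ℤ.∣ i ∣ ; n′ = ℤ.∣ j ∣

  cast-homomorphism : ℤ.+-*-rawRing -Raw-AlmostCommutative⟶ fromCommutativeRing R
  cast-homomorphism = record
    { ⟦_⟧    = cast
    ; +-homo = cast-+
    ; *-homo = cast-*
    ; -‿homo = cast-neg
    ; 0-homo = refl
    ; 1-homo = +-identityʳ 1#
    }

  cast-≟ : ∀ i j → Maybe (cast i ≈ cast j)
  cast-≟ i j with i ℤ.≟ j
  ... | yes i≡j = just (reflexive (≡.cong cast i≡j))
  ... | no _    = nothing

  open import Algebra.Solver.Ring ℤ.+-*-rawRing (fromCommutativeRing R) cast-homomorphism cast-≟ public

  polynomialRawRing : ℕ → RawRing 0ℓ 0ℓ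
  polynomialRawRing n = record
    { Carrier = Polynomial n
    ; _≈_     = _≡_
    ; _+_     = _:+_
    ; _*_     = _:*_
    ; -_      = :-_
    ; 0#      = con (+ 0)
    ; 1#      = con (+ 1)
    }

-- Written over an arbitrary raw ring so that the same formulas serve both as
-- solver polynomials and as elements of the field; in coordinates they unfold to
-- the definitions of Defs.
module QuadrilateralFormulas {a ℓ} (R : RawRing a ℓ) where
  open RawRing R

  infixl 6 _-_ _-ᵥ_
  infixr 7 _·_

  _-_ : Carrier → Carrier → Carrier
  x - y = x + - y

  _·_ : Carrier → Carrier × Carrier → Carrier × Carrier
  k · (x , y) = k * x , k * y

  _-ᵥ_ : Carrier × Carrier → Carrier × Carrier → Carrier × Carrier
  (x , y) -ᵥ (x′ , y′) = x - x′ , y - y′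

  bilinearForm : (α β γ : Carrier) → Carrier × Carrier → Carrier × Carrier → Carrier
  bilinearForm α β γ (v₁ , v₂) (w₁ , w₂) =
    v₁ * (γ * w₁ + (- β) * w₂) + v₂ * ((- β) * w₁ + α * w₂)

  αQ βQ γQ : (tA uA tB uB tA′ uA′ tB′ uB′ : Carrier) → Carrier
  αQ tA uA tB uB tA′ uA′ tB′ uB′ =
    tA * uB * uA′ * uB′ - uA * tB * uA′ * uB′
    + uA * uB * tA′ * uB′ - uA * uB * uA′ * tB′
  βQ tA uA tB uB tA′ uA′ tB′ uB′ = tA * uB * tA′ * uB′ - uA * tB * uA′ * tB′
  γQ tA uA tB uB tA′ uA′ tB′ uB′ =
    tA * tB * tA′ * uB′ - tA * tB * uA′ * tB′
    + tA * uB * tA′ * tB′ - uA * tB * tA′ * tB′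

  formQ : (tA uA tB uB tA′ uA′ tB′ uB′ : Carrier) →
          Carrier × Carrier → Carrier × Carrier → Carrier
  formQ tA uA tB uB tA′ uA′ tB′ uB′ =
    bilinearForm (αQ tA uA tB uB tA′ uA′ tB′ uB′) (βQ tA uA tB uB tA′ uA′ tB′ uB′)
                 (γQ tA uA tB uB tA′ uA′ tB′ uB′)

  lineValue : (t u v : Carrier) → Carrier × Carrier → Carrier
  lineValue t u v (x , y) = t * x - u * y + v

  det : (tL uL tM uM : Carrier) → Carrier
  det tL uL tM uM = uL * tM - tL * uM

  meet : (tL uL vL tM uM vM : Carrier) → Carrier × Carrier
  meet tL uL vL tM uM vM = vL * uM - uL * vM , tM * vL - tL * vM

  diagonal : (tL uL vL tM uM vM tL′ uL′ vL′ tM′ uM′ vM′ : Carrier) → Carrier × Carrier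
  diagonal tL uL vL tM uM vM tL′ uL′ vL′ tM′ uM′ vM′ =
    det tL uL tM uM · meet tL′ uL′ vL′ tM′ uM′ vM′
    -ᵥ det tL′ uL′ tM′ uM′ · meet tL uL vL tM uM vM

module FieldProperties {c ℓ} (F : Field c ℓ) where
  open Field F
  open import Relation.Binary.Reasoning.Setoid setoid

  x*y≈0⇒x≈0 : ∀ {x y} → ¬ y ≈ 0# → x * y ≈ 0# → x ≈ 0#
  x*y≈0⇒x≈0 {x} {y} y≉0 xy≈0 with inverse y y≉0
  ... | y⁻¹ , yy⁻¹≈1 = begin
    x              ≈⟨ *-identityʳ x ⟨
    x * 1#         ≈⟨ *-congˡ yy⁻¹≈1 ⟨
    x * (y * y⁻¹)  ≈⟨ *-assoc x y y⁻¹ ⟨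
    (x * y) * y⁻¹  ≈⟨ *-congʳ xy≈0 ⟩
    0# * y⁻¹       ≈⟨ zeroˡ y⁻¹ ⟩
    0#             ∎

  x≉0∧y≉0⇒x*y≉0 : ∀ {x y} → ¬ x ≈ 0# → ¬ y ≈ 0# → ¬ x * y ≈ 0#
  x≉0∧y≉0⇒x*y≉0 x≉0 y≉0 xy≈0 = x≉0 (x*y≈0⇒x≈0 y≉0 xy≈0)

module QuadrilateralGeometry {c ℓ} (F : Field c ℓ) where
  open Field F
  open Geometry F
  open FieldProperties F
  open import Algebra.Properties.Ring ring using (-0#≈0#; x∙y⁻¹≈ε⇒x≈y)
  open import Relation.Binary.Reasoning.Setoid setoid
  open ℤ-CoefficientRingSolver commRing using (solve; _:=_; con; _:*_; polynomialRawRing)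
  module P {n} = QuadrilateralFormulas (polynomialRawRing n)
  module C = QuadrilateralFormulas rawRing
  open C using (_·_; _-ᵥ_)

  infix 4 _≈ᵥ_
  _≈ᵥ_ : Point → Point → Set ℓ
  _≈ᵥ_ = Pointwise _≈_ _≈_

  ≈ᵥ-sym : ∀ {P P′} → P ≈ᵥ P′ → P′ ≈ᵥ P
  ≈ᵥ-sym = ×-symmetric {R = _≈_} {S = _≈_} sym sym

  direction : Line → Point
  direction L = u L , t L

  value : Line → Point → Carrier
  value L = C.lineValue (t L) (u L) (v L)

  det : Line → Line → Carrier
  det L M = C.det (t L) (u L) (t M) (u M)

  meet : Line → Line → Point
  meet L M = C.meet (t L) (u L) (v L) (t M) (u M) (v M)

  diagonal : Line → Line → Line → Line → Point
  diagonal L M L′ M′ =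
    C.diagonal (t L) (u L) (v L) (t M) (u M) (v M) (t L′) (u L′) (v L′) (t M′) (u M′) (v M′)

  ∈L-resp-≈ᵥ : ∀ L {P P′} → P ≈ᵥ P′ → P ∈L L → P′ ∈L L
  ∈L-resp-≈ᵥ L {_ , _} {_ , _} (x≈x′ , y≈y′) P∈L =
    trans (+-congʳ (+-cong (*-congˡ (sym x≈x′)) (-‿cong (*-congˡ (sym y≈y′))))) P∈L

  x≈0∧y≈0⇒x-y≈0 : ∀ {x y} → x ≈ 0# → y ≈ 0# → x - y ≈ 0#
  x≈0∧y≈0⇒x-y≈0 x≈0 y≈0 = trans (+-cong x≈0 (-‿cong y≈0)) (trans (+-identityˡ _) -0#≈0#)

  ⟪⟫-cong : ∀ {A B A′ B′ v v′ w w′} → v ≈ᵥ v′ → w ≈ᵥ w′ →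
            ⟪ v , w ⟫[ A , B , A′ , B′ ] ≈ ⟪ v′ , w′ ⟫[ A , B , A′ , B′ ]
  ⟪⟫-cong (v₁≈ , v₂≈) (w₁≈ , w₂≈) =
    +-cong (*-cong v₁≈ (+-cong (*-congˡ w₁≈) (*-congˡ w₂≈)))
           (*-cong v₂≈ (+-cong (*-congˡ w₁≈) (*-congˡ w₂≈)))

  ⟪⟫-scale : ∀ A B A′ B′ k l v w →
    ⟪ k · v , l · w ⟫[ A , B , A′ , B′ ] ≈ ⟪ v , w ⟫[ A , B , A′ , B′ ] * (k * l)
  ⟪⟫-scale A B A′ B′ k l (v₁ , v₂) (w₁ , w₂) =
    solve 9 (λ α β γ v₁ v₂ w₁ w₂ k l →
               P.bilinearForm α β γ (k P.· (v₁ , v₂)) (l P.· (w₁ , w₂))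
               := P.bilinearForm α β γ (v₁ , v₂) (w₁ , w₂) :* (k :* l))
            refl (αQ A B A′ B′) (βQ A B A′ B′) (γQ A B A′ B′) v₁ v₂ w₁ w₂ k l

  QOrthogonal-A-A′ : ∀ A B A′ B′ → QOrthogonal A B A′ B′ A A′
  QOrthogonal-A-A′ A B A′ B′ =
    solve 8 (λ tA uA tB uB tA′ uA′ tB′ uB′ →
               P.formQ tA uA tB uB tA′ uA′ tB′ uB′ (uA , tA) (uA′ , tA′) := con (+ 0))
            refl (t A) (u A) (t B) (u B) (t A′) (u A′) (t B′) (u B′)

  QOrthogonal-B-B′ : ∀ A B A′ B′ → QOrthogonal A B A′ B′ B B′
  QOrthogonal-B-B′ A B A′ B′ =
    solve 8 (λ tA uA tB uB tA′ uA′ tB′ uB′ →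
               P.formQ tA uA tB uB tA′ uA′ tB′ uB′ (uB , tB) (uB′ , tB′) := con (+ 0))
            refl (t A) (u A) (t B) (u B) (t A′) (u A′) (t B′) (u B′)

  diagonal-formulas-QOrthogonal : ∀ A B A′ B′ →
    ⟪ diagonal A B A′ B′ , diagonal B A′ B′ A ⟫[ A , B , A′ , B′ ] ≈ 0#
  diagonal-formulas-QOrthogonal A B A′ B′ =
    solve 12 (λ tA uA vA tB uB vB tA′ uA′ vA′ tB′ uB′ vB′ →
                P.formQ tA uA tB uB tA′ uA′ tB′ uB′
                  (P.diagonal tA uA vA tB uB vB tA′ uA′ vA′ tB′ uB′ vB′)
                  (P.diagonal tB uB vB tA′ uA′ vA′ tB′ uB′ vB′ tA uA vA)
                := con (+ 0))
             refl (t A) (u A) (v A) (t B) (u B) (v B)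
                  (t A′) (u A′) (v A′) (t B′) (u B′) (v B′)

  proportional⇒Parallel : ∀ L M → u L * t M ≈ t L * u M → Parallel L M
  proportional⇒Parallel L M cross with normalised L | normalised M
  ... | inj₁ (uL≈0 , tL≈1) | inj₁ (uM≈0 , tM≈1) = trans tL≈1 (sym tM≈1) , trans uL≈0 (sym uM≈0)
  ... | inj₁ (uL≈0 , tL≈1) | inj₂ uM≈1 = ⊥-elim (0≉1 (begin
    0#         ≈⟨ zeroˡ (t M) ⟨
    0# * t M   ≈⟨ *-congʳ uL≈0 ⟨
    u L * t M  ≈⟨ cross ⟩
    t L * u M  ≈⟨ *-cong tL≈1 uM≈1 ⟩
    1# * 1#    ≈⟨ *-identityˡ 1# ⟩
    1#         ∎))
  ... | inj₂ uL≈1 | inj₁ (uM≈0 , tM≈1) = ⊥-elim (0≉1 (sym (begin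
    1#         ≈⟨ *-identityˡ 1# ⟨
    1# * 1#    ≈⟨ *-cong uL≈1 tM≈1 ⟨
    u L * t M  ≈⟨ cross ⟩
    t L * u M  ≈⟨ *-congˡ uM≈0 ⟩
    t L * 0#   ≈⟨ zeroʳ (t L) ⟩
    0#         ∎)))
  ... | inj₂ uL≈1 | inj₂ uM≈1 = (begin
    t L        ≈⟨ *-identityʳ (t L) ⟨
    t L * 1#   ≈⟨ *-congˡ uM≈1 ⟨
    t L * u M  ≈⟨ cross ⟨
    u L * t M  ≈⟨ *-congʳ uL≈1 ⟩
    1# * t M   ≈⟨ *-identityˡ (t M) ⟩
    t M        ∎) , trans uL≈1 (sym uM≈1)

  det≈0⇒Parallel : ∀ L M → det L M ≈ 0# → Parallel L M
  det≈0⇒Parallel L M = proportional⇒Parallel L M ∘ x∙y⁻¹≈ε⇒x≈y _ _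

  det·P-meet : ∀ L M x y →
    det L M · (x , y) -ᵥ meet L M
      ≈ᵥ (u L * value M (x , y) - u M * value L (x , y) ,
          t L * value M (x , y) - t M * value L (x , y))
  det·P-meet L M x y =
      solve 8 (λ tL uL vL tM uM vM x y →
                 P.det tL uL tM uM :* x P.- proj₁ (P.meet tL uL vL tM uM vM)
                 := uL :* P.lineValue tM uM vM (x , y) P.- uM :* P.lineValue tL uL vL (x , y))
              refl (t L) (u L) (v L) (t M) (u M) (v M) x y
    , solve 8 (λ tL uL vL tM uM vM x y →
                 P.det tL uL tM uM :* y P.- proj₂ (P.meet tL uL vL tM uM vM)
                 := tL :* P.lineValue tM uM vM (x , y) P.- tM :* P.lineValue tL uL vL (x , y))
              refl (t L) (u L) (v L) (t M) (u M) (v M) x y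

  cramer : ∀ L M {P} → P ∈L L → P ∈L M → det L M · P ≈ᵥ meet L M
  cramer L M {x , y} P∈L P∈M =
      x∙y⁻¹≈ε⇒x≈y _ _ (trans (proj₁ (det·P-meet L M x y)) combination≈0)
    , x∙y⁻¹≈ε⇒x≈y _ _ (trans (proj₂ (det·P-meet L M x y)) combination≈0)
    where
    combination≈0 : ∀ {a b} → a * value M (x , y) - b * value L (x , y) ≈ 0#
    combination≈0 = x≈0∧y≈0⇒x-y≈0 (trans (*-congˡ P∈M) (zeroʳ _)) (trans (*-congˡ P∈L) (zeroʳ _))

  ∈L-chord : ∀ D {x y x′ y′} → (x , y) ∈L D → (x′ , y′) ∈L D →
             t D * (x′ - x) ≈ u D * (y′ - y)
  ∈L-chord D {x} {y} {x′} {y′} P∈D P′∈D = x∙y⁻¹≈ε⇒x≈y _ _ (trans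
    (solve 7 (λ t u v x y x′ y′ →
                t :* (x′ P.- x) P.- u :* (y′ P.- y)
                := P.lineValue t u v (x′ , y′) P.- P.lineValue t u v (x , y))
             refl (t D) (u D) (v D) x y x′ y′)
    (x≈0∧y≈0⇒x-y≈0 P′∈D P∈D))

  direction-of-chord : ∀ D {P P′} → P ∈L D → P′ ∈L D →
                       Σ Carrier λ κ → κ · direction D ≈ᵥ P′ -ᵥ P
  direction-of-chord D {x , y} {x′ , y′} P∈D P′∈D with normalised D
  ... | inj₁ (u≈0 , t≈1) = y′ - y , (begin
    (y′ - y) * u D       ≈⟨ *-congˡ u≈0 ⟩
    (y′ - y) * 0#        ≈⟨ zeroʳ _ ⟩
    0#                   ≈⟨ zeroˡ _ ⟨
    0# * (y′ - y)        ≈⟨ *-congʳ u≈0 ⟨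
    u D * (y′ - y)       ≈⟨ ∈L-chord D P∈D P′∈D ⟨
    t D * (x′ - x)       ≈⟨ *-congʳ t≈1 ⟩
    1# * (x′ - x)        ≈⟨ *-identityˡ _ ⟩
    x′ - x               ∎) , trans (*-congˡ t≈1) (*-identityʳ _)
  ... | inj₂ u≈1 = x′ - x , trans (*-congˡ u≈1) (*-identityʳ _) , (begin
    (x′ - x) * t D       ≈⟨ *-comm _ _ ⟩
    t D * (x′ - x)       ≈⟨ ∈L-chord D P∈D P′∈D ⟩
    u D * (y′ - y)       ≈⟨ *-congʳ u≈1 ⟩
    1# * (y′ - y)        ≈⟨ *-identityˡ _ ⟩
    y′ - y               ∎)

  chord-vanishes : ∀ {κ d P P′} → κ · d ≈ᵥ P′ -ᵥ P → κ ≈ 0# → P ≈ᵥ P′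
  chord-vanishes {κ} (κd₁≈ , κd₂≈) κ≈0 = sym (vanish κd₁≈) , sym (vanish κd₂≈)
    where
    vanish : ∀ {d a b} → κ * d ≈ a - b → a ≈ b
    vanish κd≈ = x∙y⁻¹≈ε⇒x≈y _ _ (trans (sym κd≈) (trans (*-congʳ κ≈0) (zeroˡ _)))

  scale-chord : ∀ {κ k k′ d x x′ X X′} → κ * d ≈ x′ - x → k * x ≈ X → k′ * x′ ≈ X′ →
                k * k′ * κ * d ≈ k * X′ - k′ * X
  scale-chord {κ} {k} {k′} {d} {x} {x′} {X} {X′} κd≈ kx≈ k′x′≈ = begin
    k * k′ * κ * d                 ≈⟨ *-assoc _ _ _ ⟩
    k * k′ * (κ * d)               ≈⟨ *-congˡ κd≈ ⟩
    k * k′ * (x′ - x)              ≈⟨ solve 4 (λ k k′ x x′ →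
                                        k :* k′ :* (x′ P.- x) := k :* (k′ :* x′) P.- k′ :* (k :* x))
                                      refl k k′ x x′ ⟩
    k * (k′ * x′) - k′ * (k * x)   ≈⟨ +-cong (*-congˡ k′x′≈) (-‿cong (*-congˡ kx≈)) ⟩
    k * X′ - k′ * X                ∎

  HasDirection : Line → Point → Set (c ⊔ ℓ)
  HasDirection D w = Σ Carrier λ κ → ¬ κ ≈ 0# × κ · direction D ≈ᵥ w

  diagonal-direction : ∀ L M L′ M′ D P P′ → ¬ Parallel L M → ¬ Parallel L′ M′ →
    P ∈L L → P ∈L M → P′ ∈L L′ → P′ ∈L M′ → P ∈L D → P′ ∈L D → ¬ P ≈ᵥ P′ →
    HasDirection D (diagonal L M L′ M′)
  diagonal-direction L M L′ M′ D P P′ L∦M L′∦M′ P∈L P∈M P′∈L′ P′∈M′ P∈D P′∈D P≉P′ =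
      det L M * det L′ M′ * κ
    , x≉0∧y≉0⇒x*y≉0 (x≉0∧y≉0⇒x*y≉0 (L∦M ∘ det≈0⇒Parallel L M)
                                    (L′∦M′ ∘ det≈0⇒Parallel L′ M′))
                    (P≉P′ ∘ chord-vanishes {P = P} {P′} κd≈)
    , scale-chord (proj₁ κd≈) (proj₁ (cramer L M P∈L P∈M)) (proj₁ (cramer L′ M′ P′∈L′ P′∈M′))
    , scale-chord (proj₂ κd≈) (proj₂ (cramer L M P∈L P∈M)) (proj₂ (cramer L′ M′ P′∈L′ P′∈M′))
    where
    κ : Carrier
    κ = proj₁ (direction-of-chord D {P} {P′} P∈D P′∈D)
    κd≈ : κ · direction D ≈ᵥ P′ -ᵥ P
    κd≈ = proj₂ (direction-of-chord D {P} {P′} P∈D P′∈D)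

  QOrthogonal-of-diagonal-directions : ∀ A B A′ B′ D₁ D₂ →
    HasDirection D₁ (diagonal A B A′ B′) → HasDirection D₂ (diagonal B A′ B′ A) →
    QOrthogonal A B A′ B′ D₁ D₂
  QOrthogonal-of-diagonal-directions A B A′ B′ D₁ D₂
    (κ₁ , κ₁≉0 , κ₁d₁≈) (κ₂ , κ₂≉0 , κ₂d₂≈) =
    x*y≈0⇒x≈0 (x≉0∧y≉0⇒x*y≉0 κ₁≉0 κ₂≉0) (begin
      ⟪ direction D₁ , direction D₂ ⟫[ A , B , A′ , B′ ] * (κ₁ * κ₂)
        ≈⟨ ⟪⟫-scale A B A′ B′ κ₁ κ₂ (direction D₁) (direction D₂) ⟨
      ⟪ κ₁ · direction D₁ , κ₂ · direction D₂ ⟫[ A , B , A′ , B′ ]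
        ≈⟨ ⟪⟫-cong {A} {B} {A′} {B′} κ₁d₁≈ κ₂d₂≈ ⟩
      ⟪ diagonal A B A′ B′ , diagonal B A′ B′ A ⟫[ A , B , A′ , B′ ]
        ≈⟨ diagonal-formulas-QOrthogonal A B A′ B′ ⟩
      0#
        ∎)

  QOrthogonal-diagonals : ∀ {A B A′ B′} → IsQuadrilateral A B A′ B′ →
    ∀ P₁ P₂ P₃ P₄ → P₁ ∈L A → P₁ ∈L B → P₂ ∈L B → P₂ ∈L A′ →
    P₃ ∈L A′ → P₃ ∈L B′ → P₄ ∈L B′ → P₄ ∈L A →
    ∀ D₁ D₂ → P₁ ∈L D₁ → P₃ ∈L D₁ → P₂ ∈L D₂ → P₄ ∈L D₂ → QOrthogonal A B A′ B′ D₁ D₂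
  QOrthogonal-diagonals {A} {B} {A′} {B′} Q P₁ P₂ P₃ P₄
    P₁∈A P₁∈B P₂∈B P₂∈A′ P₃∈A′ P₃∈B′ P₄∈B′ P₄∈A D₁ D₂ P₁∈D₁ P₃∈D₁ P₂∈D₂ P₄∈D₂ =
    QOrthogonal-of-diagonal-directions A B A′ B′ D₁ D₂
      (diagonal-direction A B A′ B′ D₁ P₁ P₃ npAB npA'B' P₁∈A P₁∈B P₃∈A′ P₃∈B′ P₁∈D₁ P₃∈D₁ P₁≉P₃)
      (diagonal-direction B A′ B′ A D₂ P₂ P₄ npBA' npB'A P₂∈B P₂∈A′ P₄∈B′ P₄∈A P₂∈D₂ P₄∈D₂ P₂≉P₄)
    where
    open IsQuadrilateral Q
    P₁≉P₃ : ¬ P₁ ≈ᵥ P₃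
    P₁≉P₃ P₁≈P₃ = notAllConcurrent (P₁ , P₁∈A , P₁∈B ,
      ∈L-resp-≈ᵥ A′ (≈ᵥ-sym P₁≈P₃) P₃∈A′ , ∈L-resp-≈ᵥ B′ (≈ᵥ-sym P₁≈P₃) P₃∈B′)
    P₂≉P₄ : ¬ P₂ ≈ᵥ P₄
    P₂≉P₄ P₂≈P₄ = notAllConcurrent (P₂ , ∈L-resp-≈ᵥ A (≈ᵥ-sym P₂≈P₄) P₄∈A , P₂∈B ,
      P₂∈A′ , ∈L-resp-≈ᵥ B′ (≈ᵥ-sym P₂≈P₄) P₄∈B′)

proposition2p5 : ∀ {c ℓ} (F : Field c ℓ) → CharNot2 F →
    let open Geometry F in
    (A B A' B' : Line) → IsQuadrilateral A B A' B' →
    -- the vertices A∩B, B∩A', A'∩B', B'∩A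
    (P₁ P₂ P₃ P₄ : Point) →
    P₁ ∈L A → P₁ ∈L B → P₂ ∈L B → P₂ ∈L A' →
    P₃ ∈L A' → P₃ ∈L B' → P₄ ∈L B' → P₄ ∈L A →
    -- the diagonals: D₁ through A∩B and A'∩B', D₂ through B∩A' and B'∩A
    (D₁ D₂ : Line) → P₁ ∈L D₁ → P₃ ∈L D₁ → P₂ ∈L D₂ → P₄ ∈L D₂ →
    QOrthogonal A B A' B' A A'
      × QOrthogonal A B A' B' B B'
      × QOrthogonal A B A' B' D₁ D₂
proposition2p5 F _ A B A′ B′ Q P₁ P₂ P₃ P₄ P₁∈A P₁∈B P₂∈B P₂∈A′ P₃∈A′ P₃∈B′ P₄∈B′ P₄∈A
               D₁ D₂ P₁∈D₁ P₃∈D₁ P₂∈D₂ P₄∈D₂ =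
    QOrthogonal-A-A′ A B A′ B′
  , QOrthogonal-B-B′ A B A′ B′
  , QOrthogonal-diagonals Q P₁ P₂ P₃ P₄ P₁∈A P₁∈B P₂∈B P₂∈A′ P₃∈A′ P₃∈B′ P₄∈B′ P₄∈A
                            D₁ D₂ P₁∈D₁ P₃∈D₁ P₂∈D₂ P₄∈D₂
  where open QuadrilateralGeometry F
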